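{- Let $H:\mathbb N\to\mathbb N$ be defined by $H(0)=0$ and $H(i)=i-H(H(H(i-1)))$ for $i\ge1$, and let $S=S(0)S(1)S(2)\cdots$ be the infinite word where $S(i)$ is the number of $k\ge0$ with $H(k)=i$. Then for every $n\ge1$, the number of distinct factors of length $n$ of $S$ is $2n$. -}

module Defs where

open import Data.Nat using (ℕ; zero; suc; _+_; _∸_)
open import Data.Fin using (Fin; toℕ)
open import Data.Vec using (Vec; lookup)
open import Data.List using (List; length)
open import Data.List.Relation.Unary.All using (All)
open import Data.List.Relation.Unary.Unique.Propositional using (Unique)
open import Data.List.Membership.Propositional using (_∈_)
open import Data.Product using (Σ; ∃; _×_)
open import Relation.Binary.PropositionalEquality using (_≡_)

IsH : (ℕ → ℕ) → Set
IsH H = (H 0 ≡ 0) × (∀ i → H (suc i) ≡ suc i ∸ H (H (H i)))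

HasCard : {A : Set} → (A → Set) → ℕ → Set
HasCard {A} P c =
  Σ (List A) λ xs → Unique xs × All P xs × (∀ a → P a → a ∈ xs) × (length xs ≡ c)

IsFactor : (ℕ → ℕ) → (n : ℕ) → Vec ℕ n → Set
IsFactor S n w = ∃ λ p → ∀ (j : Fin n) → lookup w j ≡ S (p + toℕ j)

FactorCount : (ℕ → ℕ) → ℕ → ℕ → Set
FactorCount S n c = HasCard (IsFactor S n) c

-- H increases by 0 or 1 at each step; call H flat at m when H (m + 1) = H m. Comparing
-- H (n + 1) + H (H (H n)) = n + 1 at n = m and n = m + 1 shows that H is flat at m + 1
-- exactly when H is flat at none of m, H m, H (H m). Hence the letters
-- u m = b if H is flat at m, c if it is flat at H m only, a otherwise,
-- satisfy a recurrence expressing u (m + 1) through u m, u (H m) and u (H (m + 1)): u is the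
-- fixed point of σ : a ↦ ab, b ↦ c, c ↦ a, and H (m + 1) - 1 is the position of the letter
-- whose image contains position m. Desubstitution shows that the only left special factors
-- of u are its prefixes, each with the three left extensions a, b, c, so u has 2n + 1
-- factors of length n. Finally S 0 = 1 and S (i + 1) is 2 or 1 according as u i is a or
-- not; under the projection a ↦ 2, b, c ↦ 1 the only factors of u of length n + 1 that merge
-- are b and c followed by the prefix, which leaves 2n + 2.

module Submission where

open import Defs
open import Data.Bool using (Bool; true; false; not; _∨_)
open import Data.Empty using (⊥)
open import Data.Fin using (Fin; zero; suc; toℕ)
open import Data.List using (List; []; _∷_; [_]; length; _++_; map)
open import Data.List.Membership.Propositional using (_∈_; _∉_)
open import Data.List.Membership.Propositional.Properties
  using (∈-map⁺; ∈-map⁻; ∈-++⁺ˡ; ∈-++⁺ʳ; ∈-++⁻)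
open import Data.List.Membership.Propositional.Properties.WithK using (unique∧set⇒bag)
open import Data.List.Properties using (length-map; length-++)
open import Data.List.Relation.Binary.BagAndSetEquality using (∼bag⇒↭)
open import Data.List.Relation.Binary.Disjoint.Propositional using (Disjoint)
open import Data.List.Relation.Binary.Permutation.Propositional.Properties using (↭-length)
open import Data.List.Relation.Unary.All as All using (All; []; _∷_)
open import Data.List.Relation.Unary.All.Properties using (All¬⇒¬Any)
import Data.List.Relation.Unary.All.Properties as All
open import Data.List.Relation.Unary.AllPairs using ([]; _∷_)
open import Data.List.Relation.Unary.Any using (here; there)
open import Data.List.Relation.Unary.Unique.Propositional using (Unique)
import Data.List.Relation.Unary.Unique.Propositional.Properties as Unique
open import Data.Nat
  using (ℕ; zero; suc; _+_; _∸_; _*_; _≤_; _<_; _≡ᵇ_; z≤n; s≤s; _<?_; _≤?_)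
open import Data.Nat.Induction using (<-rec)
open import Data.Nat.Properties
open import Algebra.Properties.CommutativeSemigroup +-commutativeSemigroup using (interchange)
open import Data.Nat.Tactic.RingSolver using (solve-∀)
open import Data.Product using (Σ; ∃; _×_; _,_; proj₁; proj₂)
open import Data.Sum using (_⊎_; inj₁; inj₂)
open import Data.Vec as Vec using (Vec; []; _∷_; lookup)
open import Data.Vec.Properties using (≡-dec; ∷-injectiveˡ; ∷-injectiveʳ; map-id)
open import Function.Bundles using (mk⇔)
open import Relation.Nullary using (Dec; yes; no; contradiction)
open import Relation.Binary.PropositionalEquality hiding ([_])

HasCard-unique : ∀ {A : Set} {P : A → Set} {m n} → HasCard P m → HasCard P n → m ≡ n
HasCard-unique (xs , xs! , Pxs , P⊆xs , refl) (ys , ys! , Pys , P⊆ys , refl) =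
  ↭-length (∼bag⇒↭ (unique∧set⇒bag xs! ys! (mk⇔ (λ x∈xs → P⊆ys _ (All.lookup Pxs x∈xs))
                                                 (λ x∈ys → P⊆xs _ (All.lookup Pys x∈ys)))))

HasCard-resp : ∀ {A : Set} {P Q : A → Set} {n} →
               (∀ x → P x → Q x) → (∀ x → Q x → P x) → HasCard P n → HasCard Q n
HasCard-resp P⇒Q Q⇒P (xs , xs! , Pxs , P⊆xs , len) =
  xs , xs! , All.map (P⇒Q _) Pxs , (λ x Qx → P⊆xs x (Q⇒P x Qx)) , len

window : {A : Set} → (ℕ → A) → ℕ → (n : ℕ) → Vec A n
window w P zero = []
window w P (suc n) = w P ∷ window w (suc P) n

map-window : ∀ {A B : Set} (g : A → B) (w : ℕ → A) P n →
             Vec.map g (window w P n) ≡ window (λ i → g (w i)) P n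
map-window g w P zero = refl
map-window g w P (suc n) = cong (g (w P) ∷_) (map-window g w (suc P) n)

lookup-window : ∀ {A : Set} (w : ℕ → A) p n (j : Fin n) →
                lookup (window w p n) j ≡ w (p + toℕ j)
lookup-window w p (suc n) zero = cong w (sym (+-identityʳ p))
lookup-window w p (suc n) (suc j) =
  trans (lookup-window w (suc p) n j) (cong w (sym (+-suc p (toℕ j))))

IsFactor⇒window : ∀ {A : Set} (w : ℕ → A) p n (v : Vec A n) →
                  (∀ j → lookup v j ≡ w (p + toℕ j)) → v ≡ window w p n
IsFactor⇒window w p zero [] _ = refl
IsFactor⇒window w p (suc n) (x ∷ v) h =
  cong₂ _∷_ (trans (h zero) (cong w (+-identityʳ p)))
            (IsFactor⇒window w (suc p) n v (λ j → trans (h (suc j)) (cong w (+-suc p (toℕ j)))))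

2[n+1]+1+1≡2n+1+3 : ∀ n → suc (2 * suc n) + 1 ≡ suc (2 * n) + 3
2[n+1]+1+1≡2n+1+3 = solve-∀

2[n+1]+1≡2n+1+2 : ∀ n → 2 * suc n + 1 ≡ suc (2 * n) + 2
2[n+1]+1≡2n+1+2 = solve-∀

data Letter : Set where
  a b c : Letter

infix 4 _≟ₗ_
_≟ₗ_ : (x y : Letter) → Dec (x ≡ y)
a ≟ₗ a = yes refl
a ≟ₗ b = no λ ()
a ≟ₗ c = no λ ()
b ≟ₗ a = no λ ()
b ≟ₗ b = yes refl
b ≟ₗ c = no λ ()
c ≟ₗ a = no λ ()
c ≟ₗ b = no λ ()
c ≟ₗ c = yes refl

a≢b : a ≢ b
a≢b ()

c≢b : c ≢ b
c≢b ()

weight : Letter → ℕ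
weight b = 0
weight _ = 1

weight-≢b : ∀ {x} → x ≢ b → weight x ≡ 1
weight-≢b {a} _ = refl
weight-≢b {b} x≢b = contradiction refl x≢b
weight-≢b {c} _ = refl

weight≡0⇒≡b : ∀ {x} → weight x ≡ 0 → x ≡ b
weight≡0⇒≡b {b} _ = refl

weight≤1 : ∀ x → weight x ≤ 1
weight≤1 a = s≤s z≤n
weight≤1 b = z≤n
weight≤1 c = s≤s z≤n

σ-head : Letter → Letter
σ-head b = c
σ-head _ = a

σ-head≢b : ∀ z → σ-head z ≢ b
σ-head≢b a ()
σ-head≢b b ()
σ-head≢b c ()

σ-head≡c⇒≡b : ∀ {z} → σ-head z ≡ c → z ≡ b
σ-head≡c⇒≡b {b} _ = refl

σ-head≡a⇒≢b : ∀ {z} → σ-head z ≡ a → z ≢ b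
σ-head≡a⇒≢b {b} () refl

≢b⇒σ-head≡a : ∀ {z} → z ≢ b → σ-head z ≡ a
≢b⇒σ-head≡a {a} _ = refl
≢b⇒σ-head≡a {b} z≢b = contradiction refl z≢b
≢b⇒σ-head≡a {c} _ = refl

σ-last : Letter → Letter
σ-last a = b
σ-last b = c
σ-last c = a

σ-last-onto : ∀ x → Σ Letter λ y → σ-last y ≡ x
σ-last-onto a = c , refl
σ-last-onto b = a , refl
σ-last-onto c = b , refl

-- The letter whose σ-image begins with x y (junk for x = b, which begins no image).
desubstitute : Letter → Letter → Letter
desubstitute a b = a
desubstitute a _ = c
desubstitute _ _ = b

-- The letter at position m + 1, from the letters at m, at f m and at f (m + 1).
next : Letter → Letter → Letter → Letter
next b _ z = σ-head z
next _ a _ = b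
next _ _ z = σ-head z

next≢b : ∀ x y z → next x y z ≢ b → next x y z ≡ σ-head z
next≢b b _ _ _ = refl
next≢b a a _ ne = contradiction refl ne
next≢b a b _ _ = refl
next≢b a c _ _ = refl
next≢b c a _ ne = contradiction refl ne
next≢b c b _ _ = refl
next≢b c c _ _ = refl

next≡b : ∀ x y z → next x y z ≡ b → x ≢ b × y ≡ a
next≡b b _ z e = contradiction e (σ-head≢b z)
next≡b a a _ _ = (λ ()) , refl
next≡b a b z e = contradiction e (σ-head≢b z)
next≡b a c z e = contradiction e (σ-head≢b z)
next≡b c a _ _ = (λ ()) , refl
next≡b c b z e = contradiction e (σ-head≢b z)
next≡b c c z e = contradiction e (σ-head≢b z)

next-≢b-a : ∀ {x} z → x ≢ b → next x a z ≡ b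
next-≢b-a {a} _ _ = refl
next-≢b-a {b} _ x≢b = contradiction refl x≢b
next-≢b-a {c} _ _ = refl

multiplicity : Letter → ℕ
multiplicity a = 2
multiplicity _ = 1

multiplicity≡2 : ∀ {x} → multiplicity x ≡ 2 → x ≡ a
multiplicity≡2 {a} _ = refl

multiplicity-≢a : ∀ {x} → x ≢ a → multiplicity x ≡ 1
multiplicity-≢a {a} x≢a = contradiction refl x≢a
multiplicity-≢a {b} _ = refl
multiplicity-≢a {c} _ = refl

increment : Bool → ℕ
increment true = 0
increment false = 1

increment-not : ∀ x → increment (not x) + increment x ≡ 1
increment-not true = refl
increment-not false = refl

-- The letter of a position, from whether H is flat there and whether it is flat at its image.
classify : Bool → Bool → Letter
classify true _ = b
classify false true = c
classify false false = a

weight-classify : ∀ x y → weight (classify x y) ≡ increment x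
weight-classify true _ = refl
weight-classify false true = refl
weight-classify false false = refl

next-classify : ∀ x y z u v →
                next (classify x y) (classify y z) (classify u v) ≡ classify (not (x ∨ y ∨ z)) u
next-classify true _ _ true _ = refl
next-classify true _ _ false true = refl
next-classify true _ _ false false = refl
next-classify false true _ true _ = refl
next-classify false true _ false true = refl
next-classify false true _ false false = refl
next-classify false false true true _ = refl
next-classify false false true false true = refl
next-classify false false true false false = refl
next-classify false false false _ _ = refl

module HofstadterLetters (H : ℕ → ℕ) (isH : IsH H) where

  H³ : ℕ → ℕ
  H³ n = H (H (H n))

  H-zero : H 0 ≡ 0
  H-zero = proj₁ isH

  H≤id : ∀ n → H n ≤ n
  H≤id zero = ≤-reflexive H-zero
  H≤id (suc n) = subst (_≤ suc n) (sym (proj₂ isH n)) (m∸n≤m (suc n) (H³ n))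

  H³≤id : ∀ n → H³ n ≤ n
  H³≤id n = ≤-trans (H≤id _) (≤-trans (H≤id _) (H≤id n))

  H-suc+H³ : ∀ n → H (suc n) + H³ n ≡ suc n
  H-suc+H³ n =
    trans (cong (_+ H³ n) (proj₂ isH n)) (m∸n+n≡m (≤-trans (H³≤id n) (n≤1+n n)))

  H-one : H 1 ≡ increment false + H 0
  H-one rewrite proj₂ isH 0 | H-zero | H-zero | H-zero = refl

  flat : ℕ → Bool
  flat m = H (suc m) ≡ᵇ H m

  UnitStepAt : ℕ → Set
  UnitStepAt m = H (suc m) ≡ increment (flat m) + H m

  flat-unique : ∀ {m} x → H (suc m) ≡ increment x + H m → flat m ≡ x
  flat-unique {m} true e with H (suc m) ≡ᵇ H m | ≡⇒≡ᵇ (H (suc m)) (H m) e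
  ... | true | _ = refl
  flat-unique {m} false e with H (suc m) ≡ᵇ H m | ≡ᵇ⇒≡ (H (suc m)) (H m)
  ... | true  | same = contradiction (trans (sym e) (same _)) 1+n≢n
  ... | false | _    = refl

  unit-step-from : ∀ {m} x → H (suc m) ≡ increment x + H m → UnitStepAt m
  unit-step-from {m} x e =
    subst (λ y → H (suc m) ≡ increment y + H m) (sym (flat-unique x e)) e

  H³-suc : ∀ m → UnitStepAt m → UnitStepAt (H m) → UnitStepAt (H (H m)) →
           H³ (suc m) ≡ increment (flat m ∨ flat (H m) ∨ flat (H (H m))) + H³ m
  H³-suc m s₁ s₂ s₃ with flat m | flat (H m) | flat (H (H m))
  ... | true  | _     | _ = cong (λ k → H (H k)) s₁
  ... | false | true  | _ = cong H (trans (cong H s₁) s₂)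
  ... | false | false | _ = trans (cong H (trans (cong H s₁) s₂)) s₃

  H-suc-suc : ∀ m x → H³ (suc m) ≡ increment x + H³ m →
              H (suc (suc m)) ≡ increment (not x) + H (suc m)
  H-suc-suc m x e = +-cancelʳ-≡ (increment x + H³ m) _ _ (begin
    H (suc (suc m)) + (increment x + H³ m)  ≡⟨ cong (H (suc (suc m)) +_) (sym e) ⟩
    H (suc (suc m)) + H³ (suc m)            ≡⟨ H-suc+H³ (suc m) ⟩
    suc (suc m)                             ≡⟨ cong suc (H-suc+H³ m) ⟨
    1 + (H (suc m) + H³ m)                  ≡⟨ cong (_+ (H (suc m) + H³ m)) (increment-not x) ⟨
    (i′ + i) + (H (suc m) + H³ m)           ≡⟨ interchange i′ i (H (suc m)) (H³ m) ⟩
    (i′ + H (suc m)) + (i + H³ m)           ∎)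
    where
      open ≡-Reasoning
      i i′ : ℕ
      i = increment x
      i′ = increment (not x)

  unit-step : ∀ m → UnitStepAt m
  unit-step = <-rec UnitStepAt λ where
    zero _ → unit-step-from false H-one
    (suc m) rec → unit-step-from _ (H-suc-suc m _ (H³-suc m (rec ≤-refl) (rec (s≤s (H≤id m)))
                                                  (rec (s≤s (≤-trans (H≤id _) (H≤id m))))))

  flat-suc : ∀ m → flat (suc m) ≡ not (flat m ∨ flat (H m) ∨ flat (H (H m)))
  flat-suc m =
    flat-unique _ (H-suc-suc m _ (H³-suc m (unit-step m) (unit-step (H m)) (unit-step (H (H m)))))

  letter : ℕ → Letter
  letter m = classify (flat m) (flat (H m))

  letter-zero : letter 0 ≡ a
  letter-zero = cong₂ classify flat-zero (trans (cong flat H-zero) flat-zero)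
    where
      flat-zero : flat 0 ≡ false
      flat-zero = flat-unique false H-one

  H-suc : ∀ m → H (suc m) ≡ weight (letter m) + H m
  H-suc m = trans (unit-step m) (cong (_+ H m) (sym (weight-classify (flat m) _)))

  letter-suc : ∀ m → letter (suc m) ≡ next (letter m) (letter (H m)) (letter (H (suc m)))
  letter-suc m = trans (cong (λ x → classify x (flat (H (suc m)))) (flat-suc m))
                       (sym (next-classify (flat m) (flat (H m)) (flat (H (H m))) (flat (H (suc m))) _))

module SelfGenerating
  (f : ℕ → ℕ) (u : ℕ → Letter) (f-zero : f 0 ≡ 0) (u-zero : u 0 ≡ a)
  (f-suc : ∀ m → f (suc m) ≡ weight (u m) + f m)
  (u-suc : ∀ m → u (suc m) ≡ next (u m) (u (f m)) (u (f (suc m)))) where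

  u-zero≢b : u 0 ≢ b
  u-zero≢b e = a≢b (trans (sym u-zero) e)

  f-suc-≢b : ∀ {m} → u m ≢ b → f (suc m) ≡ suc (f m)
  f-suc-≢b {m} ne = trans (f-suc m) (cong (_+ f m) (weight-≢b ne))

  f-suc-b : ∀ {m} → u m ≡ b → f (suc m) ≡ f m
  f-suc-b {m} e = trans (f-suc m) (cong (λ x → weight x + f m) e)

  head-of-image : ∀ {m} → u m ≢ b → u m ≡ σ-head (u (f m))
  head-of-image {zero} _ rewrite f-zero | u-zero = refl
  head-of-image {suc m} ne =
    trans (u-suc m) (next≢b (u m) (u (f m)) (u (f (suc m))) (λ e → ne (trans (u-suc m) e)))

  head-of-image-at : ∀ {m i} → u m ≢ b → f m ≡ i → u m ≡ σ-head (u i)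
  head-of-image-at ne e = trans (head-of-image ne) (cong (λ i → σ-head (u i)) e)

  before-b : ∀ {m} → u (suc m) ≡ b → u m ≡ a × u (f m) ≡ a
  before-b {m} e with next≡b (u m) (u (f m)) (u (f (suc m))) (trans (sym (u-suc m)) e)
  ... | ne , e′ = trans (head-of-image ne) (cong σ-head e′) , e′

  b-intro : ∀ {m} → u m ≢ b → u (f m) ≡ a → u (suc m) ≡ b
  b-intro {m} ne e =
    trans (u-suc m) (subst (λ y → next (u m) y (u (f (suc m))) ≡ b) (sym e) (next-≢b-a _ ne))

  no-bb : ∀ {m} → u m ≡ b → u (suc m) ≢ b
  no-bb {m} e e′ = a≢b (trans (sym (proj₁ (before-b e′))) e)

  before-c : ∀ {m} → u (suc m) ≡ c → u m ≡ b
  before-c {m} e with u m ≟ₗ b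
  ... | yes e′ = e′
  ... | no ne = contradiction (trans (sym e) (b-intro ne (proj₁ (before-b fm-suc≡b)))) c≢b
    where
      m₁≢b : u (suc m) ≢ b
      m₁≢b e′ = c≢b (trans (sym e) e′)
      fm-suc≡b : u (suc (f m)) ≡ b
      fm-suc≡b = subst (λ k → u k ≡ b) (f-suc-≢b ne) (σ-head≡c⇒≡b (trans (sym (head-of-image m₁≢b)) e))

  ≢b-after-≢b⇒a : ∀ {m} → u m ≢ b → u (suc m) ≢ b → u (suc m) ≡ a
  ≢b-after-≢b⇒a {m} ne ne′ =
    trans (head-of-image-at ne′ (f-suc-≢b ne)) (≢b⇒σ-head≡a fm-suc≢b)
    where
      fm-suc≢b : u (suc (f m)) ≢ b
      fm-suc≢b e = ne′ (b-intro ne (proj₁ (before-b e)))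

  ancestor-c⇒next≢b : ∀ {m} → u (f m) ≡ c → u (suc m) ≢ b
  ancestor-c⇒next≢b e e′ with trans (sym e) (proj₂ (before-b e′))
  ... | ()

  ancestor-desubstitute : ∀ {m} → u m ≢ b → u (f m) ≡ desubstitute (u m) (u (suc m))
  ancestor-desubstitute {m} ne with u (f m) in e
  ... | a rewrite trans (head-of-image ne) (cong σ-head e) | b-intro ne e = refl
  ... | b rewrite trans (head-of-image ne) (cong σ-head e) = refl
  ... | c rewrite trans (head-of-image ne) (cong σ-head e)
                | ≢b-after-≢b⇒a ne (ancestor-c⇒next≢b e) = refl

  block-end : ∀ m → u (suc m) ≢ b → Σ ℕ λ p → f (suc m) ≡ suc p × u m ≡ σ-last (u p)
  block-end m ne with u m ≟ₗ b
  block-end zero ne | yes e = contradiction (trans (sym u-zero) e) a≢b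
  block-end (suc m) ne | yes e =
    f m , trans (f-suc-b e) (f-suc-≢b λ e′ → a≢b (trans (sym (proj₁ (before-b e))) e′)) ,
    trans e (cong σ-last (sym (proj₂ (before-b e))))
  block-end m ne | no m≢b = f m , f-suc-≢b m≢b , last-of-image
    where
      last-of-image : u m ≡ σ-last (u (f m))
      last-of-image with u (f m) in e
      ... | a = contradiction (b-intro m≢b e) ne
      ... | b = trans (head-of-image m≢b) (cong σ-head e)
      ... | c = trans (head-of-image m≢b) (cong σ-head e)

  distinct-predecessors : ∀ {P Q} → u (suc P) ≡ u (suc Q) → u P ≢ u Q → u (suc P) ≡ a
  distinct-predecessors {P} {Q} e P≢Q with u (suc P) in e′
  ... | a = refl
  ... | b = contradiction (trans (proj₁ (before-b e′)) (sym (proj₁ (before-b (sym e))))) P≢Q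
  ... | c = contradiction (trans (before-c e′) (sym (before-c (sym e)))) P≢Q

  u-suc-from-σ-head : ∀ {x y} → u x ≢ b → u y ≢ b →
                      σ-head (u (suc x)) ≡ σ-head (u (suc y)) → u (suc x) ≡ u (suc y)
  u-suc-from-σ-head {x} {y} x≢b y≢b e with σ-head (u (suc x)) in ex
  ... | a = trans (≢b-after-≢b⇒a x≢b (σ-head≡a⇒≢b ex))
                  (sym (≢b-after-≢b⇒a y≢b (σ-head≡a⇒≢b (sym e))))
  ... | b = contradiction ex (σ-head≢b _)
  ... | c = trans (σ-head≡c⇒≡b ex) (sym (σ-head≡c⇒≡b (sym e)))

  u-suc-cong : ∀ {m m′} → u m ≡ u m′ → (u m ≢ b → u (f m) ≡ u (f m′)) →
               (u (suc m) ≢ b → σ-head (u (f (suc m))) ≡ σ-head (u (f (suc m′)))) →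
               u (suc m) ≡ u (suc m′)
  u-suc-cong {m} {m′} e ancestor next-ancestor with u (suc m) ≟ₗ b
  ... | yes sm≡b =
    trans sm≡b (sym (b-intro m′≢b (trans (sym (ancestor m≢b)) (proj₂ (before-b sm≡b)))))
    where
      m≢b : u m ≢ b
      m≢b e′ = a≢b (trans (sym (proj₁ (before-b sm≡b))) e′)
      m′≢b : u m′ ≢ b
      m′≢b e′ = m≢b (trans e e′)
  ... | no sm≢b =
    trans (head-of-image sm≢b) (trans (next-ancestor sm≢b) (sym (head-of-image sm′≢b)))
    where
      sm′≢b : u (suc m′) ≢ b
      sm′≢b e′ = sm≢b (b-intro m≢b (trans (ancestor m≢b) (proj₂ (before-b e′))))
        where
          m≢b : u m ≢ b
          m≢b e″ = a≢b (trans (sym (trans e (proj₁ (before-b e′)))) e″)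

  f-suc-≥ : ∀ m → f m ≤ f (suc m)
  f-suc-≥ m = subst (f m ≤_) (sym (f-suc m)) (m≤n+m (f m) _)

  f-suc-≤ : ∀ m → f (suc m) ≤ suc (f m)
  f-suc-≤ m = subst (_≤ suc (f m)) (sym (f-suc m)) (+-monoˡ-≤ (f m) (weight≤1 (u m)))

  f-mono-+ : ∀ k m → f m ≤ f (k + m)
  f-mono-+ zero m = ≤-refl
  f-mono-+ (suc k) m = ≤-trans (f-mono-+ k m) (f-suc-≥ (k + m))

  f-mono : ∀ {m m′} → m ≤ m′ → f m ≤ f m′
  f-mono {m} {m′} le = subst (λ k → f m ≤ f k) (m∸n+n≡m le) (f-mono-+ (m′ ∸ m) m)

  f-+-≤ : ∀ k m → f (k + m) ≤ k + f m
  f-+-≤ zero m = ≤-refl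
  f-+-≤ (suc k) m = ≤-trans (f-suc-≤ (k + m)) (s≤s (f-+-≤ k m))

  f-suc-suc-> : ∀ x → f x < f (suc (suc x))
  f-suc-suc-> x with u x ≟ₗ b
  ... | yes e = subst (f x <_) (sym (trans (f-suc-≢b (no-bb e)) (cong suc (f-suc-b e)))) ≤-refl
  ... | no ne = <-≤-trans (≤-reflexive (sym (f-suc-≢b ne))) (f-suc-≥ (suc x))

  f-after-b : ∀ {x} → u (suc x) ≡ b → ∀ N → f (suc (suc N) + x) ≤ suc N + f x
  f-after-b {x} e N = begin
    f (suc (suc N) + x)  ≡⟨ cong f (trans (+-suc N (suc x)) (cong suc (+-suc N x))) ⟨
    f (N + suc (suc x))  ≤⟨ f-+-≤ N (suc (suc x)) ⟩
    N + f (suc (suc x))  ≡⟨ cong (N +_) (f-suc-b e) ⟩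
    N + f (suc x)        ≤⟨ +-monoʳ-≤ N (f-suc-≤ x) ⟩
    N + suc (f x)        ≡⟨ +-suc N (f x) ⟩
    suc N + f x          ∎
    where open ≤-Reasoning

  offset-after-b : ∀ {x N k} → u (suc x) ≡ b → u (suc N + x) ≢ b →
                   f (suc N + x) ≡ suc k + f x → k < N
  offset-after-b {N = zero} e ne _ = contradiction e ne
  offset-after-b {x} {suc N} {k} e _ eq =
    +-cancelʳ-≤ (f x) (suc k) (suc N) (subst (_≤ suc N + f x) eq (f-after-b e N))

  Agree : ℕ → ℕ → ℕ → Set
  Agree P Q n = ∀ j → j < n → u (j + P) ≡ u (j + Q)

  Agree-snoc : ∀ {P Q n} → Agree P Q n → u (n + P) ≡ u (n + Q) → Agree P Q (suc n)
  Agree-snoc ag e j j<1+n with m≤n⇒m<n∨m≡n (≤-pred j<1+n)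
  ... | inj₁ j<n = ag j j<n
  ... | inj₂ refl = e

  Agree-≤ : ∀ {P Q m n} → m ≤ n → Agree P Q n → Agree P Q m
  Agree-≤ m≤n ag j j<m = ag j (<-≤-trans j<m m≤n)

  f-offset : ∀ {P Q n} → Agree P Q n → ∀ j → j ≤ n →
             Σ ℕ λ d → f (j + P) ≡ d + f P × f (j + Q) ≡ d + f Q
  f-offset ag zero _ = 0 , refl , refl
  f-offset {P} {Q} ag (suc j) j<n with f-offset ag j (<⇒≤ j<n)
  ... | d , eP , eQ = w + d ,
    trans (f-suc (j + P)) (trans (cong (w +_) eP) (sym (+-assoc w d (f P)))) ,
    trans (f-suc (j + Q)) (trans (cong₂ _+_ (cong weight (sym (ag j j<n))) eQ) (sym (+-assoc w d (f Q))))
    where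
      w : ℕ
      w = weight (u (j + P))

  f-increment-agree : ∀ {P Q n j d} → Agree P Q n → j ≤ n →
                      f (j + P) ≡ d + f P → f (j + Q) ≡ d + f Q
  f-increment-agree {P} {Q} {j = j} {d} ag j≤n e with f-offset ag j j≤n
  ... | d′ , eP , eQ = trans eQ (cong (_+ f Q) (+-cancelʳ-≡ (f P) d′ d (trans (sym eP) e)))

  f-attains : ∀ P m k → k + f P < f (m + P) →
              Σ ℕ λ j → j < m × f (j + P) ≡ k + f P × u (j + P) ≢ b
  f-attains P zero k lt = contradiction lt (m+n≮n k (f P))
  f-attains P (suc m) k lt with k + f P <? f (m + P)
  ... | yes lt′ with f-attains P m k lt′
  ...   | j , j<m , e , ne = j , m<n⇒m<1+n j<m , e , ne
  f-attains P (suc m) k lt | no nlt with u (m + P) ≟ₗ b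
  ...   | yes e = contradiction (subst (k + f P <_) (f-suc-b e) lt) nlt
  ...   | no ne =
    m , ≤-refl , ≤-antisym (≮⇒≥ nlt) (≤-pred (subst (k + f P <_) (f-suc-≢b ne) lt)) , ne

  ancestors-equal : ∀ {P Q K n j} → Agree (f P) (f Q) K → Agree P Q n → j ≤ n →
                    u (j + P) ≢ b → f (suc j + P) ≤ K + f P → u (f (j + P)) ≡ u (f (j + Q))
  ancestors-equal {P} {Q} {K} {j = j} agK ag j≤n ne le with f-offset ag j j≤n
  ... | d , eP , eQ = trans (cong u eP) (trans (agK d d<K) (cong u (sym eQ)))
    where
      d<K : d < K
      d<K = +-cancelʳ-≤ (f P) (suc d) K (subst (_≤ K + f P) (trans (f-suc-≢b ne) (cong suc eP)) le)

  agree-from-ancestors : ∀ {P Q K} → u P ≢ b → u Q ≢ b → Agree (f P) (f Q) K →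
                         ∀ N → f (N + P) ≤ K + f P → Agree P Q N
  agree-from-ancestors _ _ _ zero _ j ()
  agree-from-ancestors {P} {Q} {K} P≢b Q≢b agK (suc N) le = Agree-snoc ag (last N ag le)
    where
      ag : Agree P Q N
      ag = agree-from-ancestors P≢b Q≢b agK N (≤-trans (f-suc-≥ (N + P)) le)
      last : ∀ N → Agree P Q N → f (suc N + P) ≤ K + f P → u (N + P) ≡ u (N + Q)
      last zero ag le = trans (head-of-image P≢b)
        (trans (cong σ-head (ancestors-equal agK ag z≤n P≢b le)) (sym (head-of-image Q≢b)))
      last (suc N) ag le = u-suc-cong (ag N ≤-refl)
        (λ ne → ancestors-equal agK ag (n≤1+n N) ne (≤-trans (f-suc-≥ (suc N + P)) le))
        (λ ne → cong σ-head (ancestors-equal agK ag ≤-refl ne le))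

  agree-to-ancestors : ∀ {P Q N K} → Agree P Q (suc N) → K + f P ≤ f (N + P) →
                       Agree (f P) (f Q) K
  agree-to-ancestors {P} {Q} {N} {K} ag le k k<K
    with f-attains P N k (<-≤-trans (+-monoˡ-< (f P) k<K) le)
  ... | j , j<N , ej , ne = begin
    u (k + f P)                               ≡⟨ cong u ej ⟨
    u (f (j + P))                             ≡⟨ ancestor-desubstitute ne ⟩
    desubstitute (u (j + P)) (u (suc j + P))
      ≡⟨ cong₂ desubstitute (ag j j<1+N) (ag (suc j) (s≤s j<N)) ⟩
    desubstitute (u (j + Q)) (u (suc j + Q))
      ≡⟨ ancestor-desubstitute (λ e → ne (trans (ag j j<1+N) e)) ⟨
    u (f (j + Q))                             ≡⟨ cong u (f-increment-agree ag (<⇒≤ j<1+N) ej) ⟩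
    u (k + f Q)                               ∎
    where
      open ≡-Reasoning
      j<1+N : j < suc N
      j<1+N = m<n⇒m<1+n j<N

  LeftSpecialIsPrefix : ℕ → Set
  LeftSpecialIsPrefix N = ∀ {P Q} → Agree (suc P) (suc Q) N → u P ≢ u Q → Agree (suc P) 0 N

  -- Desubstitution: the windows at the ancestors of suc P and suc Q are again
  -- preceded by distinct letters, and they are shorter.
  module LeftSpecialStep (N₀ P Q : ℕ) (IH : ∀ {M} → M < suc (suc N₀) → LeftSpecialIsPrefix M)
    (ag : Agree (suc P) (suc Q) (suc (suc N₀))) (P≢Q : u P ≢ u Q) where

    P₁≢b : u (suc P) ≢ b
    P₁≢b e = a≢b (trans (sym (distinct-predecessors (ag 0 (s≤s z≤n)) P≢Q)) e)

    Q₁≢b : u (suc Q) ≢ b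
    Q₁≢b e = P₁≢b (trans (ag 0 (s≤s z≤n)) e)

    p q : ℕ
    p = proj₁ (block-end P P₁≢b)
    q = proj₁ (block-end Q Q₁≢b)

    f-P₁ : f (suc P) ≡ suc p
    f-P₁ = proj₁ (proj₂ (block-end P P₁≢b))

    f-Q₁ : f (suc Q) ≡ suc q
    f-Q₁ = proj₁ (proj₂ (block-end Q Q₁≢b))

    p≢q : u p ≢ u q
    p≢q e = P≢Q (trans (proj₂ (proj₂ (block-end P P₁≢b)))
                       (trans (cong σ-last e) (sym (proj₂ (proj₂ (block-end Q Q₁≢b))))))

    m : ℕ
    m = suc N₀ + suc P

    k : ℕ
    k = f m ∸ suc (f (suc P))

    f-m : f m ≡ suc k + f (suc P)
    f-m = trans (sym (m∸n+n≡m f-P₂≤f-m)) (+-suc k (f (suc P)))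
      where
        f-P₂≤f-m : suc (f (suc P)) ≤ f m
        f-P₂≤f-m = subst (_≤ f m) (f-suc-≢b P₁≢b)
                         (f-mono (+-monoˡ-≤ (suc P) (s≤s (z≤n {N₀}))))

    f-mQ : f (suc N₀ + suc Q) ≡ suc k + suc q
    f-mQ = trans (f-increment-agree ag (n≤1+n (suc N₀)) f-m) (cong (suc k +_) f-Q₁)

    ancestors : Agree (suc p) (suc q) (suc k)
    ancestors = subst₂ (λ x y → Agree x y (suc k)) f-P₁ f-Q₁
                       (agree-to-ancestors ag (≤-reflexive (sym f-m)))

    k≤N₀ : k ≤ N₀
    k≤N₀ = ≤-pred (+-cancelʳ-≤ (f (suc P)) (suc k) (suc N₀)
                    (subst (_≤ suc N₀ + f (suc P)) f-m (f-+-≤ (suc N₀) (suc P))))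

    ancestors-prefix : Agree (suc p) 0 (suc k)
    ancestors-prefix = IH (s≤s (s≤s k≤N₀)) ancestors p≢q

    ancestors-prefix′ : Agree (f (suc P)) (f 0) (suc k)
    ancestors-prefix′ = subst₂ (λ x y → Agree x y (suc k)) (sym f-P₁) (sym f-zero) ancestors-prefix

    P₂≡b : u (suc (suc P)) ≡ b
    P₂≡b = b-intro P₁≢b (trans (cong u f-P₁) (distinct-predecessors (ancestors 0 (s≤s z≤n)) p≢q))

    agree-init : Agree (suc P) 0 (suc N₀)
    agree-init = agree-from-ancestors {suc P} {0} {suc k} P₁≢b u-zero≢b ancestors-prefix′
                                      (suc N₀) (≤-reflexive f-m)

    f-prefix-end : f (suc N₀ + 0) ≡ suc k + 0
    f-prefix-end = trans (f-increment-agree agree-init ≤-refl f-m) (cong (suc k +_) f-zero)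

    -- After a b it is a
    -- on both sides; otherwise the ancestor windows agree one letter further and the induction
    -- hypothesis applies to them.
    next-ancestor : u m ≢ b → σ-head (u (suc k + suc p)) ≡ σ-head (u (suc k + 0))
    next-ancestor m≢b with u (k + suc p) ≟ₗ b
    ... | yes e = trans (≢b⇒σ-head≡a (no-bb e))
                        (sym (≢b⇒σ-head≡a (no-bb (trans (sym (ancestors-prefix k ≤-refl)) e))))
    ... | no ne = cong σ-head (IH (s≤s (s≤s (offset-after-b P₂≡b m≢b f-m)))
                                  (Agree-snoc ancestors last-ancestor) p≢q (suc k) ≤-refl)
      where
        mQ≢b : u (suc N₀ + suc Q) ≢ b
        mQ≢b e = m≢b (trans (ag (suc N₀) ≤-refl) e)
        σ-head-equal : σ-head (u (suc k + suc p)) ≡ σ-head (u (suc k + suc q))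
        σ-head-equal = trans (sym (head-of-image-at m≢b (trans f-m (cong (suc k +_) f-P₁))))
                             (trans (ag (suc N₀) ≤-refl) (head-of-image-at mQ≢b f-mQ))
        last-ancestor : u (suc k + suc p) ≡ u (suc k + suc q)
        last-ancestor = u-suc-from-σ-head ne (λ e → ne (trans (ancestors k ≤-refl) e)) σ-head-equal

    result : Agree (suc P) 0 (suc (suc N₀))
    result = Agree-snoc agree-init (u-suc-cong (agree-init N₀ ≤-refl)
      (λ ne → ancestors-equal ancestors-prefix′ agree-init (n≤1+n N₀) ne (≤-reflexive f-m))
      (λ ne → trans (cong (λ i → σ-head (u i)) (trans f-m (cong (suc k +_) f-P₁)))
                    (trans (next-ancestor ne) (cong (λ i → σ-head (u i)) (sym f-prefix-end)))))

  left-special-is-prefix : ∀ N → LeftSpecialIsPrefix N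
  left-special-is-prefix = <-rec LeftSpecialIsPrefix λ where
    zero _ _ _ _ ()
    (suc zero) _ ag P≢Q →
      Agree-snoc (λ _ ()) (trans (distinct-predecessors (ag 0 (s≤s z≤n)) P≢Q) (sym u-zero))
    (suc (suc N₀)) IH ag P≢Q → LeftSpecialStep.result N₀ _ _ IH ag P≢Q

  next-start : ℕ → ℕ
  next-start p with u (suc p) ≟ₗ b
  ... | yes _ = suc (suc p)
  ... | no _ = suc p

  next-start-spec : ∀ {p} → u p ≢ b → f (next-start p) ≡ suc (f p) × u (next-start p) ≢ b
  next-start-spec {p} ne with u (suc p) ≟ₗ b
  ... | yes e = trans (f-suc-b e) (f-suc-≢b ne) , no-bb e
  ... | no ne′ = f-suc-≢b ne , ne′

  -- The position where the image of the letter at position i begins.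
  start : ℕ → ℕ
  start zero = 0
  start (suc i) = next-start (start i)

  start-spec : ∀ i → f (start i) ≡ i × u (start i) ≢ b
  start-spec zero = f-zero , u-zero≢b
  start-spec (suc i) with next-start-spec (proj₂ (start-spec i))
  ... | e , ne = trans e (cong suc (proj₁ (start-spec i))) , ne

  f-preimage : ∀ {i k} → f k ≡ suc i →
               k ≡ suc (start i) ⊎ (u (suc (start i)) ≡ b × k ≡ suc (suc (start i)))
  f-preimage {i} {k} e with start i | start-spec i
  ... | p | fp , p≢b with k ≤? p
  ...   | yes k≤p = contradiction (subst (_≤ i) e (subst (f k ≤_) fp (f-mono k≤p))) 1+n≰n
  ...   | no k≰p = go (k ∸ suc p) (sym (m∸n+n≡m (≰⇒> k≰p)))
    where
      f-p₁ : f (suc p) ≡ suc i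
      f-p₁ = trans (f-suc-≢b p≢b) (cong suc fp)
      go : ∀ r → k ≡ r + suc p → k ≡ suc p ⊎ (u (suc p) ≡ b × k ≡ suc (suc p))
      go zero k≡ = inj₁ k≡
      go (suc zero) k≡ = inj₂ (weight≡0⇒≡b (+-cancelʳ-≡ (suc i) _ 0 weight+i≡i) , k≡)
        where
          weight+i≡i : weight (u (suc p)) + suc i ≡ suc i
          weight+i≡i = trans (cong (weight (u (suc p)) +_) (sym f-p₁))
                             (trans (sym (f-suc (suc p))) (trans (cong f (sym k≡)) e))
      go (suc (suc r)) k≡ = contradiction (begin-strict
        suc i                    ≡⟨ f-p₁ ⟨
        f (suc p)                <⟨ f-suc-suc-> (suc p) ⟩
        f (suc (suc (suc p)))    ≤⟨ f-mono (s≤s (s≤s (m≤n+m (suc p) r))) ⟩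
        f (suc (suc r) + suc p)  ≡⟨ cong f k≡ ⟨
        f k                      ≡⟨ e ⟩
        suc i                    ∎) (n≮n (suc i))
        where open ≤-Reasoning

  PrecedesPrefix : ℕ → Letter → Set
  PrecedesPrefix n x = Σ ℕ λ P → u P ≡ x × Agree (suc P) 0 n

  PrecedesPrefix-≤ : ∀ {m n x} → m ≤ n → PrecedesPrefix n x → PrecedesPrefix m x
  PrecedesPrefix-≤ m≤n (P , e , ag) = P , e , Agree-≤ m≤n ag

  -- σ maps x followed by the prefix p to a word ending in σ-last x followed by σ p, which is a
  -- longer prefix since p begins with a.
  precedes-prefix-σ-last : ∀ {n x} → PrecedesPrefix (suc n) x →
                           PrecedesPrefix (suc (suc n)) (σ-last x)
  precedes-prefix-σ-last {n} {x} (P , uP≡x , ag) with start (suc P) | start-spec (suc P)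
  ... | zero  | f0≡ , _ = contradiction (trans (sym f-zero) f0≡) λ ()
  ... | suc B | fB , B₁≢b = B , uB≡σ-last-x , agree
    where
      uB≡σ-last-x : u B ≡ σ-last x
      uB≡σ-last-x with block-end B B₁≢b
      ... | p , fB′ , uB =
        trans uB (cong σ-last (trans (cong u (suc-injective (trans (sym fB′) fB))) uP≡x))
      B₂≡b : u (suc (suc B)) ≡ b
      B₂≡b = b-intro B₁≢b (trans (cong u fB) (trans (ag 0 (s≤s z≤n)) u-zero))
      agree : Agree (suc B) 0 (suc (suc n))
      agree = agree-from-ancestors {suc B} {0} {suc n} B₁≢b u-zero≢b
                (subst₂ (λ y z → Agree y z (suc n)) (sym fB) (sym f-zero) ag)
                (suc (suc n)) (f-after-b B₂≡b n)

  u-one : u 1 ≡ b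
  u-one = b-intro u-zero≢b (trans (cong u f-zero) u-zero)

  u-two : u 2 ≡ c
  u-two = trans (head-of-image-at (no-bb u-one) f-two) (cong σ-head u-one)
    where
      f-two : f 2 ≡ 1
      f-two = trans (f-suc-b u-one) (trans (f-suc-≢b u-zero≢b) (cong suc f-zero))

  u-three : u 3 ≡ a
  u-three = ≢b-after-≢b⇒a (λ e → c≢b (trans (sym u-two) e)) u-three≢b
    where
      u-three≢b : u 3 ≢ b
      u-three≢b e with trans (sym u-two) (proj₁ (before-b e))
      ... | ()

  c-precedes-prefix : PrecedesPrefix 1 c
  c-precedes-prefix = 2 , u-two , Agree-snoc (λ _ ()) (trans u-three (sym u-zero))

  precedes-prefix : ∀ n x → PrecedesPrefix n x
  precedes-prefix n x = PrecedesPrefix-≤ (n≤1+n n) (precedes-prefix-suc n x)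
    where
      a-precedes-prefix : PrecedesPrefix 2 a
      a-precedes-prefix = precedes-prefix-σ-last c-precedes-prefix
      precedes-prefix-suc : ∀ n x → PrecedesPrefix (suc n) x
      precedes-prefix-suc zero a = PrecedesPrefix-≤ (s≤s z≤n) a-precedes-prefix
      precedes-prefix-suc zero b =
        PrecedesPrefix-≤ (s≤s z≤n) (precedes-prefix-σ-last a-precedes-prefix)
      precedes-prefix-suc zero c = c-precedes-prefix
      precedes-prefix-suc (suc n) x with σ-last-onto x
      ... | y , refl = precedes-prefix-σ-last (precedes-prefix-suc n y)

  Agree⇒window≡ : ∀ {P Q} n → Agree P Q n → window u P n ≡ window u Q n
  Agree⇒window≡ zero _ = refl
  Agree⇒window≡ {P} {Q} (suc n) ag = cong₂ _∷_ (ag 0 (s≤s z≤n)) (Agree⇒window≡ n tail)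
    where
      tail : Agree (suc P) (suc Q) n
      tail j j<n = subst₂ (λ x y → u x ≡ u y) (sym (+-suc j P)) (sym (+-suc j Q))
                          (ag (suc j) (s≤s j<n))

  window≡⇒Agree : ∀ {P Q} n → window u P n ≡ window u Q n → Agree P Q n
  window≡⇒Agree (suc n) e zero _ = ∷-injectiveˡ e
  window≡⇒Agree {P} {Q} (suc n) e (suc j) (s≤s j<n) =
    subst₂ (λ x y → u x ≡ u y) (+-suc j P) (+-suc j Q) (window≡⇒Agree n (∷-injectiveʳ e) j j<n)

  prefix : (n : ℕ) → Vec Letter n
  prefix = window u 0

  Factor : (n : ℕ) → Vec Letter n → Set
  Factor n v = Σ ℕ λ P → v ≡ window u P n

  left-special-window : ∀ n {P Q} → window u (suc P) n ≡ window u (suc Q) n → u P ≢ u Q →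
                        window u (suc P) n ≡ prefix n
  left-special-window n e P≢Q =
    Agree⇒window≡ n (left-special-is-prefix n (window≡⇒Agree n e) P≢Q)

  letter-before-prefix : ∀ n x → Σ ℕ λ P → u P ≡ x × window u (suc P) n ≡ prefix n
  letter-before-prefix n x with precedes-prefix n x
  ... | P , e , ag = P , e , Agree⇒window≡ n ag

  -- The factors of length n + 1 of the word κ ∘ u, counted through their left extensions:
  -- the prefix is the only factor with several of them.
  module LeftExtensions {B : Set} (κ : Letter → B) (E : List B) (n : ℕ) (E-unique : Unique E)
    (E-complete : ∀ x → κ x ∈ E) (E-sound : ∀ e → e ∈ E → ∃ λ x → κ x ≡ e)
    (κ-prefix : ∀ {v} → Factor n v → Vec.map κ v ≡ Vec.map κ (prefix n) → v ≡ prefix n)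
    (κ-injective : ∀ {P Q} → κ (u P) ≡ κ (u Q) →
                   Vec.map κ (window u (suc P) n) ≡ Vec.map κ (window u (suc Q) n) →
                   window u (suc P) n ≡ window u (suc Q) n) where

    κ-Factor : Vec B (suc n) → Set
    κ-Factor w = Σ ℕ λ P → w ≡ window (λ i → κ (u i)) P (suc n)

    non-prefix-position : ∀ {v} → Factor n v → v ≢ prefix n →
                          Σ ℕ λ P → v ≡ window u (suc P) n
    non-prefix-position (zero , e) ne = contradiction e ne
    non-prefix-position (suc P , e) _ = P , e

    extensions : (v : Vec Letter n) → Factor n v → List (Vec B (suc n))
    extensions v o with ≡-dec _≟ₗ_ v (prefix n)
    ... | yes _ = map (_∷ Vec.map κ v) E
    ... | no ne = [ κ (u (proj₁ (non-prefix-position o ne))) ∷ Vec.map κ v ]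

    tail-of-extension : ∀ v o {w} → w ∈ extensions v o → Vec.tail w ≡ Vec.map κ v
    tail-of-extension v o w∈ with ≡-dec _≟ₗ_ v (prefix n)
    ... | yes _ with ∈-map⁻ (_∷ Vec.map κ v) w∈
    ...   | _ , _ , refl = refl
    tail-of-extension v o (here refl) | no _ = refl

    head-of-extension : ∀ v o {w} → v ≢ prefix n → w ∈ extensions v o →
                        Σ ℕ λ P → v ≡ window u (suc P) n × Vec.head w ≡ κ (u P)
    head-of-extension v o ne w∈ with ≡-dec _≟ₗ_ v (prefix n)
    ... | yes e = contradiction e ne
    head-of-extension v o _ (here refl) | no ne with non-prefix-position o ne
    ... | P , e = P , e , refl

    extensions-disjoint : ∀ {v y} o oy → v ≢ y → Disjoint (extensions v o) (extensions y oy)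
    extensions-disjoint {v} {y} o oy v≢y (w∈v , w∈y) =
      by-cases (≡-dec _≟ₗ_ v (prefix n)) (≡-dec _≟ₗ_ y (prefix n))
      where
        tails : Vec.map κ v ≡ Vec.map κ y
        tails = trans (sym (tail-of-extension v o w∈v)) (tail-of-extension y oy w∈y)
        by-cases : Dec (v ≡ prefix n) → Dec (y ≡ prefix n) → ⊥
        by-cases (yes vp) (yes yp) = v≢y (trans vp (sym yp))
        by-cases (yes vp) (no yn) = yn (κ-prefix oy (trans (sym tails) (cong (Vec.map κ) vp)))
        by-cases (no vn) (yes yp) = vn (κ-prefix o (trans tails (cong (Vec.map κ) yp)))
        by-cases (no vn) (no yn) with head-of-extension v o vn w∈v | head-of-extension y oy yn w∈y
        ... | P , vP , hP | Q , yQ , hQ =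
          v≢y (trans vP (trans (κ-injective (trans (sym hP) hQ)
                                             (subst₂ (λ s t → Vec.map κ s ≡ Vec.map κ t) vP yQ tails))
                               (sym yQ)))

    extensions-sound : ∀ v o → All κ-Factor (extensions v o)
    extensions-sound v o with ≡-dec _≟ₗ_ v (prefix n)
    ... | yes vp = All.tabulate λ w∈ → realise (∈-map⁻ (_∷ Vec.map κ v) w∈)
      where
        realise : ∀ {w} → ∃ (λ e → e ∈ E × w ≡ e ∷ Vec.map κ v) → κ-Factor w
        realise (e , e∈E , refl) with E-sound e e∈E
        ... | x , refl with letter-before-prefix n x
        ...   | P , refl , e′ = P , cong (κ (u P) ∷_)
          (trans (cong (Vec.map κ) (trans vp (sym e′))) (map-window κ u (suc P) n))
    ... | no ne with non-prefix-position o ne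
    ...   | P , e = (P , cong (κ (u P) ∷_) (trans (cong (Vec.map κ) e) (map-window κ u (suc P) n))) ∷ []

    extensions-complete : ∀ v o P → v ≡ window u (suc P) n →
                          κ (u P) ∷ Vec.map κ v ∈ extensions v o
    extensions-complete v o P e with ≡-dec _≟ₗ_ v (prefix n)
    ... | yes _ = ∈-map⁺ (_∷ Vec.map κ v) (E-complete (u P))
    ... | no ne with non-prefix-position o ne
    ...   | P′ , e′ with u P ≟ₗ u P′
    ...     | yes same = here (cong (λ x → κ x ∷ Vec.map κ v) same)
    ...     | no P≢P′ = contradiction (trans e (left-special-window n (trans (sym e) e′) P≢P′)) ne

    extensions-unique : ∀ v o → Unique (extensions v o)
    extensions-unique v o with ≡-dec _≟ₗ_ v (prefix n)
    ... | yes _ = Unique.map⁺ ∷-injectiveˡ E-unique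
    ... | no _ = [] ∷ []

    extensions-length-prefix : ∀ v o → v ≡ prefix n → length (extensions v o) ≡ length E
    extensions-length-prefix v o vp with ≡-dec _≟ₗ_ v (prefix n)
    ... | yes _ = length-map _ E
    ... | no ne = contradiction vp ne

    extensions-length-other : ∀ v o → v ≢ prefix n → length (extensions v o) ≡ 1
    extensions-length-other v o ne with ≡-dec _≟ₗ_ v (prefix n)
    ... | yes vp = contradiction vp ne
    ... | no _ = refl

    extend : (xs : List (Vec Letter n)) → All (Factor n) xs → List (Vec B (suc n))
    extend [] [] = []
    extend (v ∷ xs) (o ∷ os) = extensions v o ++ extend xs os

    extend-sound : ∀ xs os → All κ-Factor (extend xs os)
    extend-sound [] [] = []
    extend-sound (v ∷ xs) (o ∷ os) = All.++⁺ (extensions-sound v o) (extend-sound xs os)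

    extend-complete : ∀ xs os → (∀ v → Factor n v → v ∈ xs) →
                      ∀ w → κ-Factor w → w ∈ extend xs os
    extend-complete xs os complete w (P , refl) =
      subst (_∈ extend xs os) (cong (κ (u P) ∷_) (map-window κ u (suc P) n))
            (go xs os (complete _ (suc P , refl)))
      where
        go : ∀ xs os → window u (suc P) n ∈ xs →
             κ (u P) ∷ Vec.map κ (window u (suc P) n) ∈ extend xs os
        go (_ ∷ xs) (o ∷ os) (here refl) = ∈-++⁺ˡ (extensions-complete _ o P refl)
        go (v ∷ xs) (o ∷ os) (there v∈) = ∈-++⁺ʳ (extensions v o) (go xs os v∈)

    ∈-extend⁻ : ∀ xs os {w} → w ∈ extend xs os →
                Σ (Vec Letter n) λ y → Σ (Factor n y) λ oy → y ∈ xs × w ∈ extensions y oy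
    ∈-extend⁻ (v ∷ xs) (o ∷ os) w∈ with ∈-++⁻ (extensions v o) w∈
    ... | inj₁ w∈v = v , o , here refl , w∈v
    ... | inj₂ w∈xs with ∈-extend⁻ xs os w∈xs
    ...   | y , oy , y∈ , w∈y = y , oy , there y∈ , w∈y

    extend-unique : ∀ xs os → Unique xs → Unique (extend xs os)
    extend-unique [] [] _ = []
    extend-unique (v ∷ xs) (o ∷ os) (v∉xs ∷ xs!) =
      Unique.++⁺ (extensions-unique v o) (extend-unique xs os xs!) disjoint
      where
        disjoint : Disjoint (extensions v o) (extend xs os)
        disjoint (w∈v , w∈xs) with ∈-extend⁻ xs os w∈xs
        ... | y , oy , y∈ , w∈y =
          extensions-disjoint o oy (λ { refl → All¬⇒¬Any v∉xs y∈ }) (w∈v , w∈y)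

    extend-length-other : ∀ xs os → prefix n ∉ xs → length (extend xs os) ≡ length xs
    extend-length-other [] [] _ = refl
    extend-length-other (v ∷ xs) (o ∷ os) p∉ = begin
      length (extensions v o ++ extend xs os)       ≡⟨ length-++ (extensions v o) ⟩
      length (extensions v o) + length (extend xs os)
        ≡⟨ cong₂ _+_ (extensions-length-other v o (λ e → p∉ (here (sym e))))
                     (extend-length-other xs os (λ p∈ → p∉ (there p∈))) ⟩
      suc (length xs)                               ∎
      where open ≡-Reasoning

    extend-length : ∀ xs os → prefix n ∈ xs → Unique xs →
                    length (extend xs os) + 1 ≡ length xs + length E
    extend-length (v ∷ xs) (o ∷ os) p∈ (v∉xs ∷ xs!) with ≡-dec _≟ₗ_ (prefix n) v
    ... | yes pv = begin
      length (extensions v o ++ extend xs os) + 1     ≡⟨ cong (_+ 1) (length-++ (extensions v o)) ⟩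
      length (extensions v o) + length (extend xs os) + 1
        ≡⟨ cong (_+ 1) (cong₂ _+_ (extensions-length-prefix v o (sym pv))
                                  (extend-length-other xs os p∉xs)) ⟩
      length E + length xs + 1                        ≡⟨ +-comm (length E + length xs) 1 ⟩
      suc (length E + length xs)                      ≡⟨ cong suc (+-comm (length E) (length xs)) ⟩
      suc (length xs) + length E                      ∎
      where
        open ≡-Reasoning
        p∉xs : prefix n ∉ xs
        p∉xs p∈ = All¬⇒¬Any v∉xs (subst (_∈ xs) pv p∈)
    ... | no p≢v with p∈
    ...   | here e = contradiction e p≢v
    ...   | there p∈′ = begin
      length (extensions v o ++ extend xs os) + 1     ≡⟨ cong (_+ 1) (length-++ (extensions v o)) ⟩
      length (extensions v o) + length (extend xs os) + 1
        ≡⟨ cong (λ l → l + length (extend xs os) + 1)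
                (extensions-length-other v o (λ e → p≢v (sym e))) ⟩
      suc (length (extend xs os) + 1)                 ≡⟨ cong suc (extend-length xs os p∈′ xs!) ⟩
      suc (length xs) + length E                      ∎
      where open ≡-Reasoning

    count : ∀ {L M} → M + 1 ≡ L + length E → HasCard (Factor n) L → HasCard κ-Factor M
    count {M = M} eq (xs , xs! , os , complete , refl) =
      extend xs os , extend-unique xs os xs! , extend-sound xs os , extend-complete xs os complete ,
      +-cancelʳ-≡ 1 _ M (trans (extend-length xs os (complete (prefix n) (0 , refl)) xs!) (sym eq))

  factor-count : ∀ n → HasCard (Factor n) (suc (2 * n))
  factor-count zero = [] ∷ [] , [] ∷ [] , (0 , refl) ∷ [] , (λ { [] _ → here refl }) , refl
  factor-count (suc n) = LeftExtensions.count (λ x → x) (a ∷ b ∷ c ∷ []) n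
    (((λ ()) ∷ (λ ()) ∷ []) ∷ ((λ ()) ∷ []) ∷ [] ∷ [])
    (λ { a → here refl ; b → there (here refl) ; c → there (there (here refl)) })
    (λ e _ → e , refl)
    (λ {v} _ e → trans (sym (map-id v)) (trans e (map-id (prefix n))))
    (λ _ e → trans (sym (map-id _)) (trans e (map-id _)))
    (2[n+1]+1+1≡2n+1+3 n) (factor-count n)

  multiplicity-step : ∀ {m m′} → multiplicity (u m) ≡ multiplicity (u m′) →
                      multiplicity (u (suc m)) ≡ multiplicity (u (suc m′)) → u (suc m) ≡ u (suc m′)
  multiplicity-step {m} {m′} hm h with u (suc m) in e₁ | u (suc m′) in e₂
  ... | a | a = refl
  ... | b | b = refl
  ... | c | c = refl
  ... | a | b = contradiction h λ ()
  ... | a | c = contradiction h λ ()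
  ... | b | a = contradiction h λ ()
  ... | c | a = contradiction h λ ()
  ... | b | c = contradiction (trans (cong multiplicity (sym (proj₁ (before-b e₁))))
                                     (trans hm (cong multiplicity (before-c e₂)))) λ ()
  ... | c | b = contradiction (trans (cong multiplicity (sym (before-c e₁)))
                                     (trans hm (cong multiplicity (proj₁ (before-b e₂))))) λ ()

  multiplicity-window-injective : ∀ n {P Q} → multiplicity (u P) ≡ multiplicity (u Q) →
    Vec.map multiplicity (window u (suc P) n) ≡ Vec.map multiplicity (window u (suc Q) n) →
    window u (suc P) n ≡ window u (suc Q) n
  multiplicity-window-injective zero _ _ = refl
  multiplicity-window-injective (suc n) {P} {Q} hm h =
    cong₂ _∷_ head (multiplicity-window-injective n (cong multiplicity head) (∷-injectiveʳ h))
    where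
      head : u (suc P) ≡ u (suc Q)
      head = multiplicity-step hm (∷-injectiveˡ h)

  multiplicity-prefix : ∀ n {v} → Factor n v →
                        Vec.map multiplicity v ≡ Vec.map multiplicity (prefix n) → v ≡ prefix n
  multiplicity-prefix zero {[]} _ _ = refl
  multiplicity-prefix (suc n) (R , refl) h =
    cong₂ _∷_ R≡0 (multiplicity-window-injective n (cong multiplicity R≡0) (∷-injectiveʳ h))
    where
      R≡0 : u R ≡ u 0
      R≡0 = trans (multiplicity≡2 (trans (∷-injectiveˡ h) (cong multiplicity u-zero))) (sym u-zero)

  MultiplicityFactor : (n : ℕ) → Vec ℕ n → Set
  MultiplicityFactor n w = Σ ℕ λ P → w ≡ window (λ i → multiplicity (u i)) P n

  multiplicity-factor-count : ∀ n → HasCard (MultiplicityFactor (suc n)) (2 * suc n)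
  multiplicity-factor-count n = LeftExtensions.count multiplicity (2 ∷ 1 ∷ []) n
    (((λ ()) ∷ []) ∷ [] ∷ [])
    (λ { a → here refl ; b → there (here refl) ; c → there (here refl) })
    (λ { _ (here refl) → a , refl ; _ (there (here refl)) → c , refl })
    (multiplicity-prefix n)
    (multiplicity-window-injective n)
    (2[n+1]+1≡2n+1+2 n) (factor-count n)

module Complexity (H : ℕ → ℕ) (isH : IsH H)
                  (S : ℕ → ℕ) (hS : ∀ i → HasCard (λ k → H k ≡ i) (S i)) where

  open HofstadterLetters H isH
  open SelfGenerating H letter H-zero letter-zero H-suc letter-suc

  S-zero : S 0 ≡ 1
  S-zero = HasCard-unique (hS 0) ((0 ∷ []) , ([] ∷ []) , (H-zero ∷ []) , only-zero , refl)
    where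
      only-zero : ∀ k → H k ≡ 0 → k ∈ 0 ∷ []
      only-zero zero _ = here refl
      only-zero (suc k) e =
        contradiction (subst₂ _≤_ (trans H-one (cong suc H-zero)) e (f-mono {1} {suc k} (s≤s z≤n)))
                      λ ()

  preimages-suc : ∀ i → HasCard (λ k → H k ≡ suc i) (multiplicity (letter i))
  preimages-suc i with start i | start-spec i | f-preimage {i}
  ... | p | Hp , p≢b | preimage with letter i ≟ₗ a
  ...   | yes li≡a = (suc p ∷ suc (suc p) ∷ []) , (((λ e → 1+n≢n (sym e)) ∷ []) ∷ [] ∷ []) ,
                     (H-p₁ ∷ trans (f-suc-b p₁≡b) H-p₁ ∷ []) , complete ,
                     cong multiplicity (sym li≡a)
    where
      H-p₁ : H (suc p) ≡ suc i
      H-p₁ = trans (f-suc-≢b p≢b) (cong suc Hp)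
      p₁≡b : letter (suc p) ≡ b
      p₁≡b = b-intro p≢b (trans (cong letter Hp) li≡a)
      complete : ∀ k → H k ≡ suc i → k ∈ suc p ∷ suc (suc p) ∷ []
      complete k e with preimage e
      ... | inj₁ refl = here refl
      ... | inj₂ (_ , refl) = there (here refl)
  ...   | no li≢a =
    (suc p ∷ []) , ([] ∷ []) , (H-p₁ ∷ []) , complete , sym (multiplicity-≢a li≢a)
    where
      H-p₁ : H (suc p) ≡ suc i
      H-p₁ = trans (f-suc-≢b p≢b) (cong suc Hp)
      complete : ∀ k → H k ≡ suc i → k ∈ suc p ∷ []
      complete k e with preimage e
      ... | inj₁ refl = here refl
      ... | inj₂ (p₁≡b , _) =
        contradiction (trans (sym (cong letter Hp)) (proj₂ (before-b p₁≡b))) li≢a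

  S-suc : ∀ i → S (suc i) ≡ multiplicity (letter i)
  S-suc i = HasCard-unique (hS (suc i)) (preimages-suc i)

  window-S : ∀ P n → window S (suc P) n ≡ window (λ i → multiplicity (letter i)) P n
  window-S P zero = refl
  window-S P (suc n) = cong₂ _∷_ (S-suc P) (window-S (suc P) n)

  -- The factor of S at position 0 also occurs after a c, whose multiplicity is S 0 = 1.
  IsFactor⇒MultiplicityFactor : ∀ n v → IsFactor S (suc n) v → MultiplicityFactor (suc n) v
  IsFactor⇒MultiplicityFactor n v (suc p , h) =
    p , trans (IsFactor⇒window S (suc p) (suc n) v h) (window-S p (suc n))
  IsFactor⇒MultiplicityFactor n v (zero , h) with letter-before-prefix n c
  ... | P , lP , after-P = P , (begin
    v                                    ≡⟨ IsFactor⇒window S 0 (suc n) v h ⟩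
    S 0 ∷ window S 1 n                   ≡⟨ cong₂ _∷_ S-zero (window-S 0 n) ⟩
    1 ∷ window μ 0 n                     ≡⟨ cong (1 ∷_) (map-window multiplicity letter 0 n) ⟨
    1 ∷ Vec.map multiplicity (prefix n)
      ≡⟨ cong₂ (λ x w → multiplicity x ∷ Vec.map multiplicity w) lP after-P ⟨
    multiplicity (letter P) ∷ Vec.map multiplicity (window letter (suc P) n)
      ≡⟨ cong (_ ∷_) (map-window multiplicity letter (suc P) n) ⟩
    window μ P (suc n)                   ∎)
    where
      open ≡-Reasoning
      μ : ℕ → ℕ
      μ i = multiplicity (letter i)

  MultiplicityFactor⇒IsFactor : ∀ n v → MultiplicityFactor n v → IsFactor S n v
  MultiplicityFactor⇒IsFactor n v (P , refl) =
    suc P , λ j → trans (cong (λ w → lookup w j) (sym (window-S P n)))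
                        (lookup-window S (suc P) n j)

  S-factor-count : ∀ n → FactorCount S (suc n) (2 * suc n)
  S-factor-count n = HasCard-resp (MultiplicityFactor⇒IsFactor (suc n))
                                  (IsFactor⇒MultiplicityFactor n) (multiplicity-factor-count n)

theorem40 : (H : ℕ → ℕ) → IsH H →
            (S : ℕ → ℕ) → (∀ i → HasCard (λ k → H k ≡ i) (S i)) →
            ∀ n → 1 ≤ n → FactorCount S n (2 * n)
theorem40 H isH S hS (suc n) _ = Complexity.S-factor-count H isH S hS n
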